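{- Let $S=(s_1,s_2,\ldots)$ be a packing sequence and $n\ge 3$. (i) If $n\le s_1+1$, then $C_n$ is not $\chi_S$-critical. (ii) If $s_1+2\le n\le 2s_1+1$, then $C_n$ is $\chi_S$-critical.
   Context: All graphs are finite and simple; $C_n$ is the cycle on $n$ vertices. A packing sequence is an infinite non-decreasing sequence $S=(s_1,s_2,\ldots)$ of positive integers. A map $c:V(G)\to\{1,\ldots,m\}$ is an $S$-packing $m$-coloring if for distinct $u,v$, $c(u)=c(v)=i$ implies $d_G(u,v)>s_i$; $\chi_S(G)$ is the least such $m$. $G$ is $\chi_S$-critical (also called $S$-packing critical) if $\chi_S(H)<\chi_S(G)$ for every proper (nonempty) subgraph $H$ of $G$. -}

module Defs where

open import Data.Nat using (ℕ; zero; suc; _+_; _*_; _≤_; _<_)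
open import Data.Fin using (Fin; toℕ)
open import Data.Product using (Σ; ∃; _×_; _,_; proj₁; proj₂)
open import Data.Sum using (_⊎_; inj₁; inj₂)
open import Data.Unit using (⊤; tt)
open import Relation.Nullary using (¬_)
open import Relation.Binary.PropositionalEquality using (_≡_; _≢_; sym)

-- A packing sequence s₁ ≤ s₂ ≤ … of positive integers, given as S : ℕ → ℕ
-- with s_i = S i for i ≥ 1 (the value S 0 is irrelevant).
PackingSeq : (ℕ → ℕ) → Set
PackingSeq S = (∀ i → 1 ≤ i → 1 ≤ S i) × (∀ i j → 1 ≤ i → i ≤ j → S i ≤ S j)

record Graph (N : ℕ) : Set₁ where
  field
    V     : Fin N → Set
    E     : Fin N → Fin N → Set
    E-V   : ∀ {u v} → E u v → V u
    E-sym : ∀ {u v} → E u v → E v u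
    E-irr : ∀ {u} → ¬ E u u
open Graph public

_⊆G_ : ∀ {N} → Graph N → Graph N → Set
H ⊆G G = (∀ v → V H v → V G v) × (∀ u v → E H u v → E G u v)

ProperSubgraph : ∀ {N} → Graph N → Graph N → Set
ProperSubgraph H G =
  (H ⊆G G) × ((∃ λ v → V G v × ¬ V H v) ⊎ (∃ λ u → ∃ λ v → E G u v × ¬ E H u v))

NonemptyG : ∀ {N} → Graph N → Set
NonemptyG H = ∃ λ v → V H v

data Walk {N : ℕ} (G : Graph N) : Fin N → Fin N → ℕ → Set where
  here : ∀ {u} → V G u → Walk G u u 0
  step : ∀ {u w v k} → E G u w → Walk G w v k → Walk G u v (suc k)

-- d_G(u,v) > s : there is no u–v walk of length ≤ s (includes d = ∞)
DistGreater : ∀ {N} → Graph N → Fin N → Fin N → ℕ → Set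
DistGreater G u v s = ∀ k → k ≤ s → ¬ Walk G u v k

IsPackingColoring : (ℕ → ℕ) → ∀ {N} → Graph N → ℕ → (Fin N → ℕ) → Set
IsPackingColoring S G m c =
  (∀ v → V G v → 1 ≤ c v × c v ≤ m) ×
  (∀ u v → V G u → V G v → u ≢ v → c u ≡ c v → DistGreater G u v (S (c u)))

PackingColorable : (ℕ → ℕ) → ∀ {N} → Graph N → ℕ → Set
PackingColorable S G m = ∃ λ c → IsPackingColoring S G m c

IsChiS : (ℕ → ℕ) → ∀ {N} → Graph N → ℕ → Set
IsChiS S G k = PackingColorable S G k × (∀ m → m < k → ¬ PackingColorable S G m)

ChiSCritical : (ℕ → ℕ) → ∀ {N} → Graph N → Set₁
ChiSCritical S {N} G =
  ∀ (H : Graph N) → ProperSubgraph H G → NonemptyG H →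
  ∀ a b → IsChiS S H a → IsChiS S G b → a < b

CycSucc : (n : ℕ) → Fin n → Fin n → Set
CycSucc n u v = (suc (toℕ u) ≡ toℕ v) ⊎ (suc (toℕ u) ≡ n × toℕ v ≡ 0)

private
  swap⊎ : ∀ {A B : Set} → A ⊎ B → B ⊎ A
  swap⊎ (inj₁ a) = inj₂ a
  swap⊎ (inj₂ b) = inj₁ b

Cycle : (n : ℕ) → Graph n
Cycle n = record
  { V = λ _ → ⊤
  ; E = λ u v → u ≢ v × (CycSucc n u v ⊎ CycSucc n v u)
  ; E-V = λ _ → tt
  ; E-sym = λ { (ne , p) → (λ eq → ne (sym eq)) , swap⊎ p }
  ; E-irr = λ { (ne , _) → ne _≡_.refl }
  }

-- A graph on n vertices in which any two vertices are joined by a walk of length at most s₁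
-- needs n colours, since each colour class has at most one vertex; both C_n for n ≤ 2s₁ + 1
-- and, when n ≤ s₁ + 1, the path P_n = C_n minus an edge have this property. So in case (i)
-- the proper subgraph P_n has χ_S = n = χ_S(C_n). In case (ii), deleting a vertex leaves
-- n − 1 vertices to colour injectively; deleting the edge jj' leaves a path from j' to j of
-- length n − 1 > s₁, so j may reuse the colour 1 of j' and n − 1 colours suffice again.
module Submission where

open import Defs
open import Data.Nat using (ℕ; zero; suc; _+_; _*_; _∸_; _≤_; _<_; z≤n; s≤s; s≤s⁻¹; _≤?_)
open import Data.Nat.Properties hiding (_≟_)
open import Data.Nat.Tactic.RingSolver using (solve-∀)
open import Data.Fin using (Fin; toℕ; fromℕ; fromℕ<; punchOut; _≟_)
open import Data.Fin.Properties using (toℕ-injective; toℕ-fromℕ; toℕ-fromℕ<; toℕ<n; pigeonhole; punchOut-injective)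
open import Data.Product using (∃; _×_; _,_; proj₁)
open import Data.Sum using (_⊎_; inj₁; inj₂)
open import Data.Unit using (⊤; tt)
open import Data.Empty using (⊥; ⊥-elim)
open import Function using (_∘_)
open import Relation.Nullary using (¬_; yes; no)
open import Relation.Binary.PropositionalEquality

module _ {N : ℕ} {G : Graph N} where

  Walk-snoc : ∀ {u v w k} → Walk G u v k → E G v w → Walk G u w (suc k)
  Walk-snoc (here _)   e = step e (here (E-V G (E-sym G e)))
  Walk-snoc (step e w) e' = step e (Walk-snoc w e')

  Walk-reverse : ∀ {u v k} → Walk G u v k → Walk G v u k
  Walk-reverse (here v)   = here v
  Walk-reverse (step e w) = Walk-snoc (Walk-reverse w) (E-sym G e)

  Walk-append : ∀ {u v w k l} → Walk G u v k → Walk G v w l → Walk G u w (k + l)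
  Walk-append (here _)   w = w
  Walk-append (step e v) w = step e (Walk-append v w)

  walk-bound : (f : Fin N → ℕ) → (∀ {x y} → E G x y → f y ≤ suc (f x)) →
               ∀ {x y k} → Walk G x y k → f y ≤ k + f x
  walk-bound f edge (here _) = ≤-refl
  walk-bound f edge {x} {y} {suc k} (step {w = w} e walk) = begin
    f y             ≤⟨ walk-bound f edge walk ⟩
    k + f w         ≤⟨ +-monoʳ-≤ k (edge e) ⟩
    k + suc (f x)   ≡⟨ +-suc k (f x) ⟩
    suc k + f x     ∎
    where open ≤-Reasoning

  successor-walk : (∀ v → V G v) → (∀ x y → suc (toℕ x) ≡ toℕ y → E G x y) →
                   ∀ d x y → toℕ y ≡ toℕ x + d → Walk G x y d
  successor-walk spanning succ zero x y y≡x+0 =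
    subst (λ z → Walk G x z 0) (toℕ-injective (trans (sym (+-identityʳ _)) (sym y≡x+0))) (here (spanning x))
  successor-walk spanning succ (suc d) x y y≡x+1+d =
    step (succ x x+1 (sym (toℕ-fromℕ< x+1<N))) (successor-walk spanning succ d x+1 y y≡x+1+d')
    where
    y≡1+x+d : toℕ y ≡ suc (toℕ x + d)
    y≡1+x+d = trans y≡x+1+d (+-suc (toℕ x) d)
    x+1<N : suc (toℕ x) < N
    x+1<N = ≤-<-trans (s≤s (m≤m+n (toℕ x) d)) (subst (_< N) y≡1+x+d (toℕ<n y))
    x+1 : Fin N
    x+1 = fromℕ< x+1<N
    y≡x+1+d' : toℕ y ≡ toℕ x+1 + d
    y≡x+1+d' = trans y≡1+x+d (cong (_+ d) (sym (toℕ-fromℕ< x+1<N)))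

module _ (S : ℕ → ℕ) {N : ℕ} {G : Graph N} where

  injective-coloring : ∀ m (c : Fin N → ℕ) → (∀ v → V G v → 1 ≤ c v × c v ≤ m) →
                       (∀ u v → V G u → V G v → c u ≡ c v → u ≡ v) → PackingColorable S G m
  injective-coloring m c bounds inj =
    c , bounds , λ u v u∈G v∈G u≢v cu≡cv → ⊥-elim (u≢v (inj u v u∈G v∈G cu≡cv))

  order-colorable : PackingColorable S G N
  order-colorable = injective-coloring N (λ v → suc (toℕ v)) (λ v _ → s≤s z≤n , toℕ<n v)
                      λ u v _ _ eq → toℕ-injective (suc-injective eq)

  IsChiS-≤ : ∀ {k m} → IsChiS S G k → PackingColorable S G m → k ≤ m
  IsChiS-≤ (_ , least) colorable = ≮⇒≥ (λ m<k → least _ m<k colorable)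

  IsChiS-unique : ∀ {a b} → IsChiS S G a → IsChiS S G b → a ≡ b
  IsChiS-unique A B = ≤-antisym (IsChiS-≤ A (proj₁ B)) (IsChiS-≤ B (proj₁ A))

Diameter≤ : ∀ {N} → Graph N → ℕ → Set
Diameter≤ G s = ∀ x y → toℕ x < toℕ y → ∃ λ k → k ≤ s × Walk G x y k

module _ {N m : ℕ} (c : Fin N → ℕ) (bounds : ∀ v → 1 ≤ c v × c v ≤ m) where

  color-index : Fin N → Fin m
  color-index v with c v | bounds v
  ... | suc i | _ , i<m = fromℕ< i<m

  color-index-injective : ∀ u v → color-index u ≡ color-index v → c u ≡ c v
  color-index-injective u v eq with c u | bounds u | c v | bounds v
  ... | suc i | _ , i<m | suc j | _ , j<m =
    cong suc (trans (sym (toℕ-fromℕ< i<m)) (trans (cong toℕ eq) (toℕ-fromℕ< j<m)))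

-- By pigeonhole two vertices share a colour i ≥ 1, yet they are joined by a walk of length ≤ s₁ ≤ s_i.
IsChiS-order : ∀ S → PackingSeq S → ∀ {N} (G : Graph N) → (∀ v → V G v) →
               Diameter≤ G (S 1) → IsChiS S G N
IsChiS-order S (_ , mono) {N} G spanning diam = order-colorable S , fewer-colors-fail
  where
  fewer-colors-fail : ∀ m → m < N → ¬ PackingColorable S G m
  fewer-colors-fail m m<N (c , bounds , separated)
    with i , j , i<j , same-index ← pigeonhole m<N (color-index c (λ v → bounds v (spanning v)))
    with k , k≤s₁ , walk ← diam i j i<j
    = separated i j (spanning i) (spanning j) (λ i≡j → <⇒≢ i<j (cong toℕ i≡j))
        (color-index-injective c _ i j same-index) k
        (≤-trans k≤s₁ (mono 1 (c i) ≤-refl (proj₁ (bounds i (spanning i))))) walk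

Path : (n : ℕ) → Graph n
Path n = record
  { V     = λ _ → ⊤
  ; E     = λ u v → (suc (toℕ u) ≡ toℕ v) ⊎ (suc (toℕ v) ≡ toℕ u)
  ; E-V   = λ _ → tt
  ; E-sym = λ { (inj₁ p) → inj₂ p ; (inj₂ p) → inj₁ p }
  ; E-irr = λ { (inj₁ p) → 1+n≢n p ; (inj₂ p) → 1+n≢n p }
  }

successor≢ : ∀ {n} {x y : Fin n} → suc (toℕ x) ≡ toℕ y → x ≢ y
successor≢ p refl = 1+n≢n p

Path⊆Cycle : ∀ n → Path n ⊆G Cycle n
Path⊆Cycle n = (λ _ _ → tt) ,
  λ { u v (inj₁ p) → successor≢ p , inj₁ (inj₁ p)
    ; u v (inj₂ p) → (λ u≡v → successor≢ p (sym u≡v)) , inj₂ (inj₁ p) }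

Path-walk : ∀ n d (x y : Fin n) → toℕ y ≡ toℕ x + d → Walk (Path n) x y d
Path-walk n = successor-walk (λ _ → tt) λ _ _ p → inj₁ p

Cycle-walk : ∀ n d (x y : Fin n) → toℕ y ≡ toℕ x + d → Walk (Cycle n) x y d
Cycle-walk n = successor-walk (λ _ → tt) λ _ _ p → successor≢ p , inj₁ (inj₁ p)

Path-diameter : ∀ s n → n ≤ s + 1 → Diameter≤ (Path n) s
Path-diameter s n n≤s+1 x y x<y with d , x+d≡y ← m≤n⇒∃[o]m+o≡n (<⇒≤ x<y) =
  d , d≤s , Path-walk n d x y (sym x+d≡y)
  where
  d≤s : d ≤ s
  d≤s = s≤s⁻¹ (begin
    suc d           ≤⟨ s≤s (m≤n+m d (toℕ x)) ⟩
    suc (toℕ x + d) ≡⟨ cong suc x+d≡y ⟩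
    suc (toℕ y)     ≤⟨ toℕ<n y ⟩
    n               ≤⟨ n≤s+1 ⟩
    s + 1           ≡⟨ +-comm s 1 ⟩
    suc s           ∎)
    where open ≤-Reasoning

Cycle-wrap-edge : ∀ m → E (Cycle (2 + m)) (fromℕ (suc m)) Fin.zero
Cycle-wrap-edge m = (λ ()) , inj₁ (inj₂ (cong suc (toℕ-fromℕ (suc m)) , refl))

wrap-length≤ : ∀ s x d y r n → s < d → x + d ≡ y → y + r ≡ n → suc n ≤ 2 * s + 1 → r + suc x ≤ s
wrap-length≤ s x d y r n s<d x+d≡y y+r≡n n<2s+1 = +-cancelʳ-≤ (suc s) (r + suc x) s (begin
  r + suc x + suc s ≤⟨ +-monoʳ-≤ (r + suc x) s<d ⟩
  r + suc x + d     ≡⟨ rearrange r x d ⟩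
  suc (x + d + r)   ≡⟨ cong (λ z → suc (z + r)) x+d≡y ⟩
  suc (y + r)       ≡⟨ cong suc y+r≡n ⟩
  suc n             ≤⟨ n<2s+1 ⟩
  2 * s + 1         ≡⟨ double s ⟩
  s + suc s         ∎)
  where
  open ≤-Reasoning
  rearrange : ∀ r x d → r + suc x + d ≡ suc (x + d + r)
  rearrange = solve-∀
  double : ∀ s → 2 * s + 1 ≡ s + suc s
  double = solve-∀

-- A pair at forward distance d > s is joined the other way round, through the edge (n − 1, 0).
Cycle-diameter : ∀ s m → 2 + m ≤ 2 * s + 1 → Diameter≤ (Cycle (2 + m)) s
Cycle-diameter s m n≤2s+1 x y x<y with d , x+d≡y ← m≤n⇒∃[o]m+o≡n (<⇒≤ x<y) with d ≤? s
... | yes d≤s = d , d≤s , Cycle-walk (2 + m) d x y (sym x+d≡y)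
... | no d≰s with r , y+r≡1+m ← m≤n⇒∃[o]m+o≡n (s≤s⁻¹ (toℕ<n y)) =
  r + suc (toℕ x) , wrap-length≤ s (toℕ x) d (toℕ y) r (suc m) (≰⇒> d≰s) x+d≡y y+r≡1+m n≤2s+1 ,
  Walk-reverse (Walk-append y→last (step (Cycle-wrap-edge m) 0→x))
  where
  y→last : Walk (Cycle (2 + m)) y (fromℕ (suc m)) r
  y→last = Cycle-walk (2 + m) r y _ (trans (toℕ-fromℕ (suc m)) (sym y+r≡1+m))
  0→x : Walk (Cycle (2 + m)) Fin.zero x (toℕ x)
  0→x = Cycle-walk (2 + m) (toℕ x) Fin.zero x refl

missing-vertex-colorable : ∀ S {m} (H : Graph (suc m)) w → ¬ V H w → PackingColorable S H m
missing-vertex-colorable S {m} H w w∉H = injective-coloring S m color bounds injective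
  where
  color : Fin (suc m) → ℕ
  color x with w ≟ x
  ... | yes _   = 1
  ... | no  w≢x = suc (toℕ (punchOut w≢x))
  bounds : ∀ v → V H v → 1 ≤ color v × color v ≤ m
  bounds v v∈H with w ≟ v
  ... | yes refl = ⊥-elim (w∉H v∈H)
  ... | no  w≢v  = s≤s z≤n , toℕ<n (punchOut w≢v)
  injective : ∀ u v → V H u → V H v → color u ≡ color v → u ≡ v
  injective u v u∈H v∈H eq with w ≟ u | w ≟ v
  ... | yes refl | _        = ⊥-elim (w∉H u∈H)
  ... | no  _    | yes refl = ⊥-elim (w∉H v∈H)
  ... | no  w≢u  | no  w≢v  = punchOut-injective w≢u w≢v (toℕ-injective (suc-injective eq))

CycSucc-functional : ∀ {n} {x y z : Fin n} → CycSucc n x y → CycSucc n x z → y ≡ z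
CycSucc-functional (inj₁ a)       (inj₁ b)       = toℕ-injective (trans (sym a) b)
CycSucc-functional {y = y} (inj₁ a) (inj₂ (b , _)) = ⊥-elim (<-irrefl (trans (sym a) b) (toℕ<n y))
CycSucc-functional {z = z} (inj₂ (a , _)) (inj₁ b) = ⊥-elim (<-irrefl (trans (sym b) a) (toℕ<n z))
CycSucc-functional (inj₂ (_ , a)) (inj₂ (_ , b)) = toℕ-injective (trans a (sym b))

-- C_n cut open between j and its successor: the vertices j + 1, …, n − 1, 0, …, j
-- (as numbers) get the consecutive positions j + 1, …, j + n.
module Unrolled {m : ℕ} (j : Fin (suc m)) where

  unrolled : ℕ → ℕ
  unrolled x with x ≤? toℕ j
  ... | yes _ = x + suc m
  ... | no  _ = x

  unrolled-succ : ∀ x y → x ≢ toℕ j → (suc x ≡ y) ⊎ (suc x ≡ suc m × y ≡ 0) →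
                  unrolled y ≡ suc (unrolled x)
  unrolled-succ x .(suc x) x≢j (inj₁ refl) with x ≤? toℕ j | suc x ≤? toℕ j
  ... | yes _   | yes _   = refl
  ... | yes x≤j | no  x≥j = ⊥-elim (x≥j (≤∧≢⇒< x≤j x≢j))
  ... | no  x>j | yes x<j = ⊥-elim (x>j (≤-trans (n≤1+n x) x<j))
  ... | no  _   | no  _   = refl
  unrolled-succ x .0 x≢j (inj₂ (x+1≡n , refl)) with x ≤? toℕ j
  ... | yes x≤j = ⊥-elim (x≢j (≤-antisym x≤j (s≤s⁻¹ (subst (toℕ j <_) (sym x+1≡n) (toℕ<n j)))))
  ... | no  _   = sym x+1≡n

  unrolled-j : unrolled (toℕ j) ≡ toℕ j + suc m
  unrolled-j with toℕ j ≤? toℕ j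
  ... | yes _   = refl
  ... | no  j≰j = ⊥-elim (j≰j ≤-refl)

  j<unrolled : ∀ x → toℕ j < unrolled x
  j<unrolled x with x ≤? toℕ j
  ... | yes _   = ≤-trans (toℕ<n j) (m≤n+m (suc m) x)
  ... | no  x≰j = ≰⇒> x≰j

  unrolled≤ : ∀ x → x < suc m → x ≢ toℕ j → unrolled x ≤ toℕ j + m
  unrolled≤ x x<n x≢j with x ≤? toℕ j
  ... | yes x≤j = ≤-trans (≤-reflexive (+-suc x m)) (+-monoˡ-≤ m (≤∧≢⇒< x≤j x≢j))
  ... | no  _   = ≤-trans (s≤s⁻¹ x<n) (m≤n+m m (toℕ j))

  unrolled-injective : ∀ x y → x < suc m → y < suc m → unrolled x ≡ unrolled y → x ≡ y
  unrolled-injective x y x<n y<n eq with x ≤? toℕ j | y ≤? toℕ j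
  ... | yes _ | yes _ = +-cancelʳ-≡ (suc m) x y eq
  ... | yes _ | no  _ = ⊥-elim (<⇒≱ y<n (≤-trans (m≤n+m (suc m) x) (≤-reflexive eq)))
  ... | no  _ | yes _ = ⊥-elim (<⇒≱ x<n (≤-trans (m≤n+m (suc m) y) (≤-reflexive (sym eq))))
  ... | no  _ | no  _ = eq

missing-edge-colorable : ∀ S {m} (H : Graph (suc m)) → H ⊆G Cycle (suc m) → S 1 + 2 ≤ suc m →
                         ∀ j j' → CycSucc (suc m) j j' → ¬ E H j j' → PackingColorable S H m
missing-edge-colorable S {m} H (_ , H⊆C) n≥s₁+2 j j' j→j' jj'∉H = color , bounds , separated
  where
  open Unrolled j

  position : Fin (suc m) → ℕ
  position x = unrolled (toℕ x)

  position-injective : ∀ {u v} → position u ≡ position v → u ≡ v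
  position-injective {u} {v} eq = toℕ-injective (unrolled-injective (toℕ u) (toℕ v) (toℕ<n u) (toℕ<n v) eq)

  position-edge : ∀ {x y} → E H x y → position y ≤ suc (position x)
  position-edge {x} {y} xy∈H with H⊆C x y xy∈H
  ... | _ , inj₁ x→y = ≤-reflexive (unrolled-succ (toℕ x) (toℕ y) x≢j x→y)
    where
    x≢j : toℕ x ≢ toℕ j
    x≢j x≡j with refl ← toℕ-injective x≡j with refl ← CycSucc-functional x→y j→j' = jj'∉H xy∈H
  ... | _ , inj₂ y→x = begin
    position y             ≤⟨ n≤1+n (position y) ⟩
    suc (position y)       ≡⟨ unrolled-succ (toℕ y) (toℕ x) y≢j y→x ⟨
    position x             ≤⟨ n≤1+n (position x) ⟩
    suc (position x)       ∎
    where
    open ≤-Reasoning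
    y≢j : toℕ y ≢ toℕ j
    y≢j y≡j with refl ← toℕ-injective y≡j with refl ← CycSucc-functional y→x j→j' = jj'∉H (E-sym H xy∈H)

  far-from-j : ∀ {v k} → Walk H j v k → position v ≡ suc (toℕ j) → k ≤ S 1 → ⊥
  far-from-j {v} {k} walk pos k≤s₁ =
    <⇒≱ (≤-trans (≤-reflexive (+-comm 2 (S 1))) n≥s₁+2) (+-cancelʳ-≤ (toℕ j) (suc m) (suc (S 1)) (begin
    suc m + toℕ j      ≡⟨ +-comm (suc m) (toℕ j) ⟩
    toℕ j + suc m      ≡⟨ unrolled-j ⟨
    position j         ≤⟨ walk-bound position position-edge (Walk-reverse walk) ⟩
    k + position v     ≡⟨ cong (k +_) pos ⟩
    k + suc (toℕ j)    ≤⟨ +-monoˡ-≤ (suc (toℕ j)) k≤s₁ ⟩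
    S 1 + suc (toℕ j)  ≡⟨ +-suc (S 1) (toℕ j) ⟩
    suc (S 1) + toℕ j  ∎))
    where open ≤-Reasoning

  color : Fin (suc m) → ℕ
  color x with x ≟ j
  ... | yes _ = 1
  ... | no  _ = position x ∸ toℕ j

  color≡1 : ∀ v → position v ∸ toℕ j ≡ 1 → position v ≡ suc (toℕ j)
  color≡1 v eq = trans (sym (m∸n+n≡m (<⇒≤ (j<unrolled (toℕ v))))) (cong (_+ toℕ j) eq)

  bounds : ∀ v → V H v → 1 ≤ color v × color v ≤ m
  bounds v _ with v ≟ j
  ... | yes _   = s≤s z≤n , s≤s⁻¹ (≤-trans (m≤n+m 2 (S 1)) n≥s₁+2)
  ... | no  v≢j = m<n⇒0<n∸m (j<unrolled (toℕ v)) ,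
                  m≤n+o⇒m∸n≤o (position v) (toℕ j) (unrolled≤ (toℕ v) (toℕ<n v) (v≢j ∘ toℕ-injective))

  separated : ∀ u v → V H u → V H v → u ≢ v → color u ≡ color v → DistGreater H u v (S (color u))
  separated u v _ _ u≢v same k k≤ walk with u ≟ j | v ≟ j
  ... | yes refl | yes refl = u≢v refl
  ... | yes refl | no  _    = far-from-j walk (color≡1 v (sym same)) k≤
  ... | no  _    | yes refl = far-from-j (Walk-reverse walk) (color≡1 u same) (subst (λ c → k ≤ S c) same k≤)
  ... | no  _    | no  _    =
    u≢v (position-injective (∸-cancelʳ-≡ (<⇒≤ (j<unrolled (toℕ u))) (<⇒≤ (j<unrolled (toℕ v))) same))

proper-subgraph-colorable : ∀ S {m} (H : Graph (suc m)) → S 1 + 2 ≤ suc m →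
                            ProperSubgraph H (Cycle (suc m)) → PackingColorable S H m
proper-subgraph-colorable S H _ (_ , inj₁ (w , _ , w∉H)) =
  missing-vertex-colorable S H w w∉H
proper-subgraph-colorable S H n≥s₁+2 (H⊆C , inj₂ (u , v , (_ , inj₁ u→v) , uv∉H)) =
  missing-edge-colorable S H H⊆C n≥s₁+2 u v u→v uv∉H
proper-subgraph-colorable S H n≥s₁+2 (H⊆C , inj₂ (u , v , (_ , inj₂ v→u) , uv∉H)) =
  missing-edge-colorable S H H⊆C n≥s₁+2 v u v→u (uv∉H ∘ E-sym H)

proposition4p1 : (S : ℕ → ℕ) → PackingSeq S → (n : ℕ) → 3 ≤ n →
    (n ≤ S 1 + 1 → ¬ ChiSCritical S (Cycle n)) ×
    (S 1 + 2 ≤ n → n ≤ 2 * S 1 + 1 → ChiSCritical S (Cycle n))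
proposition4p1 S packing 1 (s≤s ())
proposition4p1 S packing 2 (s≤s (s≤s ()))
proposition4p1 S packing n@(suc (suc (suc k))) _ = not-critical , critical
  where
  χS-Cycle : n ≤ 2 * S 1 + 1 → IsChiS S (Cycle n) n
  χS-Cycle n≤2s₁+1 = IsChiS-order S packing (Cycle n) (λ _ → tt) (Cycle-diameter (S 1) (suc k) n≤2s₁+1)

  Path-proper : ProperSubgraph (Path n) (Cycle n)
  Path-proper = Path⊆Cycle n ,
    inj₂ (fromℕ (2 + k) , Fin.zero , Cycle-wrap-edge (suc k) , λ { (inj₁ ()) ; (inj₂ ()) })

  not-critical : n ≤ S 1 + 1 → ¬ ChiSCritical S (Cycle n)
  not-critical n≤s₁+1 critical = n≮n n (critical (Path n) Path-proper (Fin.zero , tt) n n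
    (IsChiS-order S packing (Path n) (λ _ → tt) (Path-diameter (S 1) n n≤s₁+1))
    (χS-Cycle (≤-trans n≤s₁+1 (+-monoˡ-≤ 1 (m≤m+n (S 1) (S 1 + 0))))))

  critical : S 1 + 2 ≤ n → n ≤ 2 * S 1 + 1 → ChiSCritical S (Cycle n)
  critical n≥s₁+2 n≤2s₁+1 H proper _ a b χH χC = begin-strict
    a      ≤⟨ IsChiS-≤ S χH (proper-subgraph-colorable S H n≥s₁+2 proper) ⟩
    2 + k  <⟨ n<1+n (2 + k) ⟩
    n      ≡⟨ IsChiS-unique S (χS-Cycle n≤2s₁+1) χC ⟩
    b      ∎
    where open ≤-Reasoning
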